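{- For $1\leq i\leq n$ and $1\leq r\leq n$, \[|\mathcal{I}^{(r)}_{x_i}(P_n^*)|\leq|\mathcal{I}^{(r)}_{p_i}(P_n^*)|.\]
   Context: $P_n$ is the path graph with vertices $x_1,\dots,x_n$ and edges $x_jx_{j+1}$ ($1\leq j\leq n-1$), and the pendant graph $P_n^*$ has vertex set $\{x_1,\dots,x_n\}\sqcup\{p_1,\dots,p_n\}$ and edge set $E(P_n)\sqcup\{x_1p_1,\dots,x_np_n\}$. For a graph $H$, $\mathcal{I}^{(r)}_v(H)$ is the family of independent sets of size $r$ in $H$ containing the vertex $v$. -}

module Defs where

open import Data.Nat using (ℕ; zero; suc; _+_; _<_)
open import Data.Nat.Properties using (_≟_; _<?_)
open import Data.Bool using (true; false)
open import Data.Fin using (Fin; toℕ; _↑ˡ_; _↑ʳ_)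
open import Data.Fin.Properties using (all?)
open import Data.Fin.Subset using (Subset; _∈_; ∣_∣)
open import Data.Fin.Subset.Properties using (_∈?_)
open import Data.Vec using ([]; _∷_)
open import Data.List using (List; []; _∷_; map; _++_; filter; length)
open import Data.Product using (_×_)
open import Data.Sum using (_⊎_)
open import Relation.Nullary using (¬_; Dec)
open import Relation.Nullary.Decidable using (_×-dec_; _⊎-dec_; _→-dec_; ¬?)
open import Relation.Binary.PropositionalEquality using (_≡_)

record Graph (m : ℕ) : Set₁ where
  field
    Adj  : Fin m → Fin m → Set
    adj? : ∀ u v → Dec (Adj u v)
open Graph public

-- The pendant graph P_n^* on vertex set Fin (n + n).
-- Vertex x_{i+1} is the index i  (i : Fin n, written  x i  = i ↑ˡ n),
-- vertex p_{i+1} is the index n+i (written  p i  = n ↑ʳ i).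

x : ∀ {n} → Fin n → Fin (n + n)
x {n} i = i ↑ˡ n

p : ∀ {n} → Fin n → Fin (n + n)
p {n} i = n ↑ʳ i

-- Directed edge list on ℕ indices a b (with 0-based x-indices < n):
--   path edge     x_a x_{a+1} :  a < n, b < n, b ≡ a + 1
--   pendant edge  x_a p_a     :  a < n, b ≡ n + a
PendantArc : ℕ → ℕ → ℕ → Set
PendantArc n a b = (a < n × (b < n × b ≡ suc a)) ⊎ (a < n × b ≡ n + a)

pendantArc? : ∀ n a b → Dec (PendantArc n a b)
pendantArc? n a b =
  (a <? n ×-dec (b <? n ×-dec b ≟ suc a)) ⊎-dec (a <? n ×-dec b ≟ n + a)

PendantAdj : (n : ℕ) → Fin (n + n) → Fin (n + n) → Set
PendantAdj n u v = PendantArc n (toℕ u) (toℕ v) ⊎ PendantArc n (toℕ v) (toℕ u)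

Pendant : (n : ℕ) → Graph (n + n)
Pendant n = record
  { Adj  = PendantAdj n
  ; adj? = λ u v → pendantArc? n (toℕ u) (toℕ v) ⊎-dec pendantArc? n (toℕ v) (toℕ u)
  }

IsIndependent : ∀ {m} → Graph m → Subset m → Set
IsIndependent {m} G S = ∀ (u : Fin m) → ∀ (v : Fin m) → u ∈ S → v ∈ S → ¬ Adj G u v

isIndependent? : ∀ {m} (G : Graph m) (S : Subset m) → Dec (IsIndependent G S)
isIndependent? G S =
  all? λ u → all? λ v → (u ∈? S) →-dec ((v ∈? S) →-dec ¬? (adj? G u v))

allSubsets : ∀ m → List (Subset m)
allSubsets zero    = [] ∷ []
allSubsets (suc m) = map (true ∷_) (allSubsets m) ++ map (false ∷_) (allSubsets m)

Ivr : ∀ {m} → Graph m → ℕ → Fin m → List (Subset m)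
Ivr G r v = filter (λ S → isIndependent? G S ×-dec ((∣ S ∣ ≟ r) ×-dec (v ∈? S))) (allSubsets _)

countIvr : ∀ {m} → Graph m → ℕ → Fin m → ℕ
countIvr G r v = length (Ivr G r v)

module Submission where

-- If v is a leaf whose only neighbour is u, then S ↦ (S ∖ {u}) ∪ {v} maps the
-- independent r-sets containing u into those containing v: v ∉ S because u ∈ S,
-- so the size is preserved, and v can only conflict with u, which has been
-- removed.  Moving v back to u undoes the map, so it is injective.  In the
-- pendant graph every p_i is a leaf hanging from x_i.

open import Defs
open import Data.Nat using (ℕ; suc; _+_; _≤_; _<_; z≤n; s≤s)
open import Data.Nat.Properties using (_≟_; ≤⇒≯; m≤m+n; +-cancelˡ-≡; module ≤-Reasoning)
open import Data.Bool using (true; false)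
open import Data.Fin as Fin using (Fin; toℕ)
open import Data.Fin.Properties using (toℕ-↑ˡ; toℕ-↑ʳ; toℕ-injective; toℕ<n) renaming (_≟_ to _≟ᶠ_)
open import Data.Fin.Subset using (Subset; inside; outside; ∣_∣; _∈_; _∉_)
open import Data.Fin.Subset.Properties using (_∈?_)
open import Data.Vec using (Vec; []; _∷_; lookup; _[_]≔_; _[_]=_)
open import Data.Vec.Properties using (∷-injectiveʳ; []=-injective; []=⇒lookup; lookup⇒[]=; []≔-updates; []≔-idempotent; []≔-commutes; updateAt-id-local; lookup∘updateAt′)
open import Data.List using (List; []; _∷_; map; _++_; length)
open import Data.List.Properties using (length-map; length-++-sucʳ)
open import Data.List.Membership.Propositional using () renaming (_∈_ to _∈ₗ_)
open import Data.List.Membership.Propositional.Properties using (∈-map⁺; ∈-map⁻; ∈-++⁺ˡ; ∈-++⁺ʳ; ∈-++⁻; ∈-∃++; ∈-filter⁺; ∈-filter⁻)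
open import Data.List.Relation.Binary.Subset.Propositional using (_⊆_)
open import Data.List.Relation.Unary.Any using (here; there)
open import Data.List.Relation.Unary.All as All using ()
open import Data.List.Relation.Unary.Unique.Propositional using (Unique; []; _∷_)
import Data.List.Relation.Unary.Unique.Propositional.Properties as Unique
open import Data.Product using (_×_; _,_; proj₁; proj₂)
open import Data.Sum using (_⊎_; inj₁; inj₂)
open import Relation.Nullary using (¬_; yes; no; contradiction)
open import Relation.Nullary.Decidable using (_×-dec_)
open import Relation.Unary using (Decidable)
open import Relation.Binary.PropositionalEquality using (_≡_; _≢_; refl; sym; trans; cong; subst; module ≡-Reasoning)

length-≤-⊆ : ∀ {A : Set} {xs ys : List A} → Unique xs → xs ⊆ ys → length xs ≤ length ys
length-≤-⊆ {xs = []} _ _ = z≤n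
length-≤-⊆ {xs = a ∷ xs} (a∉xs ∷ xs!) a∷xs⊆ys with ∈-∃++ (a∷xs⊆ys (here refl))
... | bs , cs , refl =
  subst (suc (length xs) ≤_) (sym (length-++-sucʳ bs a cs)) (s≤s (length-≤-⊆ xs! xs⊆bs++cs))
  where
  xs⊆bs++cs : xs ⊆ bs ++ cs
  xs⊆bs++cs b∈xs with ∈-++⁻ bs (a∷xs⊆ys (there b∈xs))
  ... | inj₁ b∈bs         = ∈-++⁺ˡ b∈bs
  ... | inj₂ (here b≡a)   = contradiction (sym b≡a) (All.lookup a∉xs b∈xs)
  ... | inj₂ (there b∈cs) = ∈-++⁺ʳ bs b∈cs

allSubsets-complete : ∀ {m} (s : Subset m) → s ∈ₗ allSubsets m
allSubsets-complete []                  = here refl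
allSubsets-complete {suc m} (true ∷ s)  = ∈-++⁺ˡ (∈-map⁺ (true ∷_) (allSubsets-complete s))
allSubsets-complete {suc m} (false ∷ s) = ∈-++⁺ʳ (map (true ∷_) (allSubsets m)) (∈-map⁺ (false ∷_) (allSubsets-complete s))

allSubsets-unique : ∀ m → Unique (allSubsets m)
allSubsets-unique 0       = All.[] ∷ []
allSubsets-unique (suc m) =
  Unique.++⁺ (Unique.map⁺ ∷-injectiveʳ (allSubsets-unique m)) (Unique.map⁺ ∷-injectiveʳ (allSubsets-unique m)) disjoint
  where
  disjoint : ∀ {s} → ¬ (s ∈ₗ map (true ∷_) (allSubsets m) × s ∈ₗ map (false ∷_) (allSubsets m))
  disjoint (s∈trues , s∈falses) with ∈-map⁻ (true ∷_) s∈trues | ∈-map⁻ (false ∷_) s∈falses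
  ... | _ , _ , refl | _ , _ , ()

∉⇒lookup≡outside : ∀ {m} {s : Subset m} {i : Fin m} → i ∉ s → lookup s i ≡ outside
∉⇒lookup≡outside {s = s} {i} i∉s with lookup s i in eq
... | true  = contradiction (lookup⇒[]= i s eq) i∉s
... | false = refl

[]≔-minimal⁻ : ∀ {m} {A : Set} (xs : Vec A m) {i j : Fin m} {a b : A} → i ≢ j →
               (xs [ j ]≔ b) [ i ]= a → xs [ i ]= a
[]≔-minimal⁻ xs {i} {j} i≢j xs[j]≔b[i]=a =
  lookup⇒[]= i xs (trans (sym (lookup∘updateAt′ i j i≢j xs)) ([]=⇒lookup xs[j]≔b[i]=a))

∣[]≔inside∣ : ∀ {m} (s : Subset m) (i : Fin m) → ∣ s [ i ]≔ inside ∣ ≡ suc ∣ s [ i ]≔ outside ∣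
∣[]≔inside∣ (_ ∷ s) Fin.zero         = refl
∣[]≔inside∣ (true ∷ s) (Fin.suc i)  = cong suc (∣[]≔inside∣ s i)
∣[]≔inside∣ (false ∷ s) (Fin.suc i) = ∣[]≔inside∣ s i

move : ∀ {m} → Fin m → Fin m → Subset m → Subset m
move u v s = (s [ u ]≔ outside) [ v ]≔ inside

module _ {m} {s : Subset m} {u v : Fin m} (u∈s : u ∈ s) (v∉s : v ∉ s) where

  private
    u≢v : u ≢ v
    u≢v u≡v = v∉s (subst (_∈ s) u≡v u∈s)

    s[v]≔outside≡s : s [ v ]≔ outside ≡ s
    s[v]≔outside≡s = updateAt-id-local v s (sym (∉⇒lookup≡outside v∉s))

    s[u]≔inside≡s : s [ u ]≔ inside ≡ s
    s[u]≔inside≡s = updateAt-id-local u s (sym ([]=⇒lookup u∈s))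

  ∣move∣ : ∣ move u v s ∣ ≡ ∣ s ∣
  ∣move∣ = begin
    ∣ (s [ u ]≔ outside) [ v ]≔ inside ∣        ≡⟨ ∣[]≔inside∣ (s [ u ]≔ outside) v ⟩
    suc ∣ (s [ u ]≔ outside) [ v ]≔ outside ∣   ≡⟨ cong (λ t → suc ∣ t ∣) ([]≔-commutes s u v u≢v) ⟩
    suc ∣ (s [ v ]≔ outside) [ u ]≔ outside ∣   ≡⟨ cong (λ t → suc ∣ t [ u ]≔ outside ∣) s[v]≔outside≡s ⟩
    suc ∣ s [ u ]≔ outside ∣                    ≡⟨ sym (∣[]≔inside∣ s u) ⟩
    ∣ s [ u ]≔ inside ∣                         ≡⟨ cong ∣_∣ s[u]≔inside≡s ⟩
    ∣ s ∣                                       ∎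
    where open ≡-Reasoning

  move-move : move v u (move u v s) ≡ s
  move-move = begin
    (((s [ u ]≔ outside) [ v ]≔ inside) [ v ]≔ outside) [ u ]≔ inside
      ≡⟨ cong (_[ u ]≔ inside) ([]≔-idempotent (s [ u ]≔ outside) v) ⟩
    ((s [ u ]≔ outside) [ v ]≔ outside) [ u ]≔ inside
      ≡⟨ cong (_[ u ]≔ inside) ([]≔-commutes s u v u≢v) ⟩
    ((s [ v ]≔ outside) [ u ]≔ outside) [ u ]≔ inside
      ≡⟨ []≔-idempotent (s [ v ]≔ outside) u ⟩
    (s [ v ]≔ outside) [ u ]≔ inside
      ≡⟨ cong (_[ u ]≔ inside) s[v]≔outside≡s ⟩
    s [ u ]≔ inside
      ≡⟨ s[u]≔inside≡s ⟩
    s ∎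
    where open ≡-Reasoning

∈-move⁻ : ∀ {m} (s : Subset m) {u v w : Fin m} → w ∈ move u v s → w ≡ v ⊎ (w ≢ u × w ∈ s)
∈-move⁻ s {u} {v} {w} w∈ with w ≟ᶠ v | w ≟ᶠ u
... | yes w≡v | _        = inj₁ w≡v
... | no w≢v  | yes refl = contradiction ([]=-injective ([]≔-updates s u) u∈s[u]≔outside) λ ()
  where
  u∈s[u]≔outside : u ∈ s [ u ]≔ outside
  u∈s[u]≔outside = []≔-minimal⁻ (s [ u ]≔ outside) w≢v w∈
... | no w≢v  | no w≢u   = inj₂ (w≢u , []≔-minimal⁻ s w≢u ([]≔-minimal⁻ (s [ u ]≔ outside) w≢v w∈))

v∈move : ∀ {m} (s : Subset m) (u v : Fin m) → v ∈ move u v s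
v∈move s u v = []≔-updates (s [ u ]≔ outside) v

IsLeafOf : ∀ {m} → Graph m → Fin m → Fin m → Set
IsLeafOf G v u = Adj G u v × (∀ w → Adj G v w ⊎ Adj G w v → w ≡ u)

module _ {m} (G : Graph m) {u v : Fin m} (leaf : IsLeafOf G v u) where

  private
    u~v : Adj G u v
    u~v = proj₁ leaf

    neighbour≡u : ∀ w → Adj G v w ⊎ Adj G w v → w ≡ u
    neighbour≡u = proj₂ leaf

  leaf∉ : ∀ {s} → IsIndependent G s → u ∈ s → v ∉ s
  leaf∉ ind u∈s v∈s = ind u v u∈s v∈s u~v

  move-independent : ∀ {s} → IsIndependent G s → u ∈ s → IsIndependent G (move u v s)
  move-independent {s} ind u∈s a b a∈ b∈ a~b with ∈-move⁻ s a∈ | ∈-move⁻ s b∈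
  ... | inj₁ refl      | inj₁ refl      = leaf∉ ind u∈s (subst (_∈ s) (sym (neighbour≡u a (inj₁ a~b))) u∈s)
  ... | inj₁ refl      | inj₂ (b≢u , _) = b≢u (neighbour≡u b (inj₁ a~b))
  ... | inj₂ (a≢u , _) | inj₁ refl      = a≢u (neighbour≡u a (inj₂ a~b))
  ... | inj₂ (_ , a∈s) | inj₂ (_ , b∈s) = ind a b a∈s b∈s a~b

module _ {m} (G : Graph m) (r : ℕ) where

  private
    ivr? : ∀ v → Decidable (λ s → IsIndependent G s × ∣ s ∣ ≡ r × v ∈ s)
    ivr? v S = isIndependent? G S ×-dec ((∣ S ∣ ≟ r) ×-dec (v ∈? S))

  ∈-Ivr⁻ : ∀ {v s} → s ∈ₗ Ivr G r v → IsIndependent G s × ∣ s ∣ ≡ r × v ∈ s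
  ∈-Ivr⁻ {v} s∈ = proj₂ (∈-filter⁻ (ivr? v) {xs = allSubsets m} s∈)

  ∈-Ivr⁺ : ∀ {v s} → IsIndependent G s → ∣ s ∣ ≡ r → v ∈ s → s ∈ₗ Ivr G r v
  ∈-Ivr⁺ {v} {s} ind ∣s∣≡r v∈s = ∈-filter⁺ (ivr? v) (allSubsets-complete s) (ind , ∣s∣≡r , v∈s)

  Ivr-unique : ∀ v → Unique (Ivr G r v)
  Ivr-unique v = Unique.filter⁺ (ivr? v) (allSubsets-unique m)

  countIvr-≤-leaf : ∀ {u v} → IsLeafOf G v u → countIvr G r u ≤ countIvr G r v
  countIvr-≤-leaf {u} {v} leaf = begin
    length (Ivr G r u)                    ≤⟨ length-≤-⊆ (Ivr-unique u) Ivr[u]⊆ ⟩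
    length (map (move v u) (Ivr G r v))   ≡⟨ length-map (move v u) (Ivr G r v) ⟩
    length (Ivr G r v)                    ∎
    where
    open ≤-Reasoning
    Ivr[u]⊆ : Ivr G r u ⊆ map (move v u) (Ivr G r v)
    Ivr[u]⊆ {s} s∈ with ∈-Ivr⁻ s∈
    ... | ind , ∣s∣≡r , u∈s =
      subst (_∈ₗ map (move v u) (Ivr G r v)) (move-move u∈s v∉s) (∈-map⁺ (move v u) moved∈)
      where
      v∉s : v ∉ s
      v∉s = leaf∉ G leaf ind u∈s

      moved∈ : move u v s ∈ₗ Ivr G r v
      moved∈ = ∈-Ivr⁺ (move-independent G leaf ind u∈s) (trans (∣move∣ u∈s v∉s) ∣s∣≡r) (v∈move s u v)

module _ {n} (i : Fin n) where

  private
    n≤toℕ-p : n ≤ toℕ (p i)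
    n≤toℕ-p = subst (n ≤_) (sym (toℕ-↑ʳ n i)) (m≤m+n n (toℕ i))

    no-arc-from-p : ∀ b → ¬ PendantArc n (toℕ (p i)) b
    no-arc-from-p _ (inj₁ (p<n , _)) = ≤⇒≯ n≤toℕ-p p<n
    no-arc-from-p _ (inj₂ (p<n , _)) = ≤⇒≯ n≤toℕ-p p<n

    arc-into-p : ∀ w → PendantArc n (toℕ w) (toℕ (p i)) → w ≡ x i
    arc-into-p _ (inj₁ (_ , p<n , _)) = contradiction p<n (≤⇒≯ n≤toℕ-p)
    arc-into-p w (inj₂ (_ , p≡n+w))  = toℕ-injective (begin
      toℕ w      ≡⟨ +-cancelˡ-≡ n _ _ (trans (sym p≡n+w) (toℕ-↑ʳ n i)) ⟩
      toℕ i      ≡⟨ sym (toℕ-↑ˡ i n) ⟩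
      toℕ (x i)  ∎)
      where open ≡-Reasoning

    x~p : PendantAdj n (x i) (p i)
    x~p = inj₁ (inj₂ (subst (_< n) (sym (toℕ-↑ˡ i n)) (toℕ<n i) , trans (toℕ-↑ʳ n i) (cong (n +_) (sym (toℕ-↑ˡ i n)))))

  p-isLeafOf-x : IsLeafOf (Pendant n) (p i) (x i)
  p-isLeafOf-x = x~p , neighbour≡x
    where
    neighbour≡x : ∀ w → PendantAdj n (p i) w ⊎ PendantAdj n w (p i) → w ≡ x i
    neighbour≡x w (inj₁ (inj₁ arc)) = contradiction arc (no-arc-from-p _)
    neighbour≡x w (inj₁ (inj₂ arc)) = arc-into-p w arc
    neighbour≡x w (inj₂ (inj₁ arc)) = arc-into-p w arc
    neighbour≡x w (inj₂ (inj₂ arc)) = contradiction arc (no-arc-from-p _)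

lemma5 : (n : ℕ) (i : Fin n) (r : ℕ) → 1 ≤ r → r ≤ n →
    countIvr (Pendant n) r (x i) ≤ countIvr (Pendant n) r (p i)
lemma5 n i r _ _ = countIvr-≤-leaf (Pendant n) r (p-isLeafOf-x i)
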